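{- If $G$ is any blowup of the Petersen graph, then $\chi(G)\le\lceil\frac54\omega(G)\rceil$.
   Context: Graphs are finite and simple. A blowup of a graph $H$ is any graph $G$ whose vertex set can be partitioned into $|V(H)|$ (not necessarily non-empty) cliques $Q_v$, $v\in V(H)$, such that for distinct $u,v$, every vertex of $Q_u$ is adjacent to every vertex of $Q_v$ if $uv\in E(H)$, and no vertex of $Q_u$ is adjacent to a vertex of $Q_v$ if $uv\notin E(H)$. $\chi$ is the chromatic number and $\omega$ the clique number. -}

module Defs where

open import Data.Nat using (ℕ; _+_; _*_; _/_; _≤_)
open import Data.Fin using (Fin; _<_)
open import Data.Product using (Σ; _×_; _,_; proj₁; proj₂; ∃; ∃-syntax)
open import Data.Sum using (_⊎_)
open import Relation.Nullary using (¬_)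
open import Relation.Binary.PropositionalEquality using (_≡_; _≢_)
open import Function.Definitions using (Injective)
open import Level using (0ℓ)

record Graph (n : ℕ) : Set₁ where
  field
    Adj   : Fin n → Fin n → Set
    sym   : ∀ {x y} → Adj x y → Adj y x
    irrefl : ∀ {x} → ¬ Adj x x
open Graph public

-- Petersen graph: vertices are 2-element subsets {i,j} (i < j) of a 5-set,
-- adjacent iff disjoint (Kneser graph K(5,2)).
PVertex : Set
PVertex = Σ (Fin 5 × Fin 5) (λ p → proj₁ p < proj₂ p)

PAdj : PVertex → PVertex → Set
PAdj ((i , j) , _) ((k , l) , _) = (i ≢ k) × (i ≢ l) × (j ≢ k) × (j ≢ l)

-- G is a blowup of the Petersen graph: a map f assigning each vertex of G to
-- a Petersen vertex v (so Q_v = f⁻¹(v), possibly empty), such that each Q_v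
-- is a clique, and between distinct parts Q_u, Q_v adjacency is complete if
-- uv is a Petersen edge and empty otherwise.
IsPetersenBlowup : ∀ {n} → Graph n → Set
IsPetersenBlowup {n} G =
  Σ (Fin n → PVertex) λ f → ( (∀ x y → x ≢ y → f x ≡ f y → Adj G x y)
         × (∀ x y → f x ≢ f y → (PAdj (f x) (f y) → Adj G x y))
         × (∀ x y → f x ≢ f y → (Adj G x y → PAdj (f x) (f y))) )

IsClique : ∀ {n} → Graph n → (k : ℕ) → (Fin k → Fin n) → Set
IsClique G k q = Injective _≡_ _≡_ q × (∀ i j → i ≢ j → Adj G (q i) (q j))

HasClique : ∀ {n} → Graph n → ℕ → Set
HasClique {n} G k = Σ (Fin k → Fin n) λ q → IsClique {n} G k q

IsCliqueNumber : ∀ {n} → Graph n → ℕ → Set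
IsCliqueNumber G w = HasClique G w × (∀ k → HasClique G k → k ≤ w)

-- Proper colouring with k colours; χ(G) ≤ k iff G is k-colourable.
Colourable : ∀ {n} → Graph n → ℕ → Set
Colourable {n} G k = Σ (Fin n → Fin k) λ c → (∀ (x y : Fin n) → Adj G x y → c x ≢ c y)

ceil5/4 : ℕ → ℕ
ceil5/4 w = (5 * w + 3) / 4

-- A blowup is determined by its part sizes n : V → ℕ on the Petersen graph, here the
-- Kneser graph K(5,2) of 2-subsets of {0,…,4}; its clique number w bounds n u + n v on
-- edges, and colouring it means giving each part n v colours, disjoint on adjacent parts.
-- For any k with w ≤ 4k (for ⌈5w/4⌉ take k = ⌈w/4⌉) we colour with k + w colours.
-- Call v heavy if n v > 2k. Heavy vertices are pairwise non-adjacent, so they share a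
-- common element a or contain a triangle {a,b},{b,c},{a,c}. Then some star (the four
-- 2-sets through one element e) is admissible: its total excess over k is at most w and
-- at most one of its vertices is heavy. For a triangle take e outside {a,b,c}; in the
-- other case average over the stars of the four elements e ≠ a, using the three perfect
-- matchings of those four. After relabelling by a permutation of {0,…,4} the admissible
-- star is the star of 0, coloured by an explicit layout of intervals of colours.

module Submission where

open import Defs hiding (sym)
open import Data.Nat using (ℕ; zero; suc; _+_; _*_; _∸_; _⊔_; _≤_; _<_; z≤n; s≤s; z<s; s≤s⁻¹; _≤?_; _<?_; _/_; _%_)
open import Data.Nat.Properties hiding (_≟_; <-irrelevant)
open import Data.Nat.DivMod using (m≡m%n+[m/n]*n; m%n<n; m*n/n≡m; +-distrib-/-∣ʳ)
open import Data.Nat.Divisibility using (divides)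
open import Data.Nat.Tactic.RingSolver using (solve-∀)
open import Data.Fin using (Fin; zero; suc; toℕ; fromℕ<)
import Data.Fin as Fin
open import Data.Fin.Patterns using (0F; 1F; 2F; 3F; 4F)
open import Data.Fin.Properties using (_≟_; all?; any?; <-irrelevant; toℕ-injective; toℕ<n; toℕ-fromℕ<)
  renaming (_<?_ to _<ᶠ?_)
open import Data.Fin.Permutation using (Permutation′; _⟨$⟩ʳ_; _⟨$⟩ˡ_; inverseˡ; inverseʳ; flip; _∘ₚ_; transpose)
open import Data.List using (List; []; _∷_; _++_; map; length; filter; lookup; allFin)
open import Data.List.Properties using (length-++)
open import Data.List.Membership.Propositional using (_∈_)
open import Data.List.Membership.Propositional.Properties using (∈-filter⁺; ∈-filter⁻; ∈-allFin; ∈-lookup; ∈-++⁻)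
open import Data.List.Relation.Unary.All as All using (All; []; _∷_)
import Data.List.Relation.Unary.All.Properties as All
open import Data.List.Relation.Unary.AllPairs as AllPairs using (AllPairs; []; _∷_; allPairs?)
import Data.List.Relation.Unary.AllPairs.Properties as AllPairs
open import Data.List.Relation.Unary.Any using (Any; here; there; index)
open import Data.List.Relation.Unary.Any.Properties using (lookup-index)
open import Data.List.Relation.Unary.Unique.Propositional using (Unique)
open import Data.List.Relation.Unary.Unique.Propositional.Properties using (filter⁺; allFin⁺; ++⁺)
open import Data.Product using (Σ; _×_; _,_; proj₁; proj₂)
open import Data.Sum using (_⊎_; inj₁; inj₂)
open import Data.Empty using (⊥-elim)
open import Relation.Binary.Definitions using (tri<; tri≈; tri>)
open import Relation.Binary.PropositionalEquality
  using (_≡_; _≢_; refl; sym; trans; cong; cong₂; subst; subst₂)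
open import Relation.Nullary using (Dec; yes; no; ¬_; ¬?)
open import Relation.Nullary.Decidable using (_×-dec_; _⊎-dec_; _→-dec_; map′; from-yes; True; toWitness)

open ≤-Reasoning

∸-+-≡-⊔ : ∀ m n → m ∸ n + n ≡ m ⊔ n
∸-+-≡-⊔ m       zero    = trans (+-identityʳ m) (sym (⊔-identityʳ m))
∸-+-≡-⊔ zero    (suc n) = refl
∸-+-≡-⊔ (suc m) (suc n) = trans (+-suc (m ∸ n) n) (cong suc (∸-+-≡-⊔ m n))

-- (a ⊔ P) + (b ⊔ Q) is one of the four sums a+b, a+Q, P+b, P+Q.
⊔-+-⊔-≤ : ∀ {a b P Q w} → a + b ≤ w → a + Q ≤ w → P + b ≤ w → P + Q ≤ w →
          (a ⊔ P) + (b ⊔ Q) ≤ w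
⊔-+-⊔-≤ {a} {b} {P} {Q} {w} ab aQ Pb PQ = begin
  (a ⊔ P) + (b ⊔ Q)                    ≡⟨ +-distribʳ-⊔ (b ⊔ Q) a P ⟩
  (a + (b ⊔ Q)) ⊔ (P + (b ⊔ Q))        ≡⟨ cong₂ _⊔_ (+-distribˡ-⊔ a b Q) (+-distribˡ-⊔ P b Q) ⟩
  ((a + b) ⊔ (a + Q)) ⊔ ((P + b) ⊔ (P + Q)) ≤⟨ ⊔-lub (⊔-lub ab aQ) (⊔-lub Pb PQ) ⟩
  w                                    ∎

top-up-≤ : ∀ {a b P Q w} → a + b ≤ w → a + Q ≤ w → P + b ≤ w → P + Q ≤ w →
           (a ∸ P) + (b ∸ Q) + (P + Q) ≤ w
top-up-≤ {a} {b} {P} {Q} {w} ab aQ Pb PQ = begin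
  (a ∸ P) + (b ∸ Q) + (P + Q)   ≡⟨ regroup (a ∸ P) (b ∸ Q) P Q ⟩
  (a ∸ P + P) + (b ∸ Q + Q)     ≡⟨ cong₂ _+_ (∸-+-≡-⊔ a P) (∸-+-≡-⊔ b Q) ⟩
  (a ⊔ P) + (b ⊔ Q)             ≤⟨ ⊔-+-⊔-≤ {a} {b} {P} {Q} ab aQ Pb PQ ⟩
  w                             ∎
  where
  regroup : ∀ x y P Q → x + y + (P + Q) ≡ (x + P) + (y + Q)
  regroup = solve-∀

excess≤k : ∀ {a} k → a ≤ 2 * k → a ∸ k ≤ k
excess≤k {a} k a≤2k = m≤n+o⇒m∸n≤o a k (subst (a ≤_) (cong (k +_) (+-identityʳ k)) a≤2k)

excess-pair : ∀ {a b} k → b ≤ 2 * k → (a ∸ k) + (b ∸ k) ≤ a ⊔ b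
excess-pair {a} {b} k b≤2k with a ≤? k
... | yes a≤k = begin
  (a ∸ k) + (b ∸ k)  ≡⟨ cong (_+ (b ∸ k)) (m≤n⇒m∸n≡0 a≤k) ⟩
  b ∸ k              ≤⟨ m∸n≤m b k ⟩
  b                  ≤⟨ m≤n⊔m a b ⟩
  a ⊔ b              ∎
... | no a≰k = begin
  (a ∸ k) + (b ∸ k)  ≤⟨ +-monoʳ-≤ (a ∸ k) (excess≤k k b≤2k) ⟩
  (a ∸ k) + k        ≡⟨ m∸n+n≡m (<⇒≤ (≰⇒> a≰k)) ⟩
  a                  ≤⟨ m≤m⊔n a b ⟩
  a ⊔ b              ∎

room-for-excesses : ∀ {h a b w} k → h + a ≤ w → h + b ≤ w → a ≤ 2 * k ⊎ b ≤ 2 * k →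
                    h + ((a ∸ k) + (b ∸ k)) ≤ w
room-for-excesses {h} {a} {b} {w} k ha hb light = begin
  h + ((a ∸ k) + (b ∸ k))  ≤⟨ +-monoʳ-≤ h (bound light) ⟩
  h + (a ⊔ b)              ≡⟨ +-distribˡ-⊔ h a b ⟩
  (h + a) ⊔ (h + b)        ≤⟨ ⊔-lub ha hb ⟩
  w                        ∎
  where
  bound : a ≤ 2 * k ⊎ b ≤ 2 * k → (a ∸ k) + (b ∸ k) ≤ a ⊔ b
  bound (inj₂ b≤2k) = excess-pair k b≤2k
  bound (inj₁ a≤2k) = begin
    (a ∸ k) + (b ∸ k)  ≡⟨ +-comm (a ∸ k) (b ∸ k) ⟩
    (b ∸ k) + (a ∸ k)  ≤⟨ excess-pair k a≤2k ⟩
    b ⊔ a              ≡⟨ ⊔-comm b a ⟩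
    a ⊔ b              ∎

beside-heavy : ∀ {a h w} k → a + h ≤ w → 2 * k < h → w ≤ 4 * k →
               a ≤ 2 * k × 4 * (a ∸ k) ≤ w
beside-heavy {a} {h} {w} k a+h≤w 2k<h w≤4k = a≤2k , quarter
  where
  a+2k≤w : a + 2 * k ≤ w
  a+2k≤w = ≤-trans (+-monoʳ-≤ a (<⇒≤ 2k<h)) a+h≤w
  a≤2k : a ≤ 2 * k
  a≤2k = +-cancelʳ-≤ (2 * k) a (2 * k)
           (≤-trans a+2k≤w (≤-trans w≤4k (≤-reflexive (four≡two+two k))))
    where
    four≡two+two : ∀ k → 4 * k ≡ 2 * k + 2 * k
    four≡two+two = solve-∀
  quarter : 4 * (a ∸ k) ≤ w
  quarter with k ≤? a
  ... | no k≰a = subst (_≤ w) (sym (cong (4 *_) (m≤n⇒m∸n≡0 (<⇒≤ (≰⇒> k≰a))))) z≤n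
  ... | yes k≤a = begin
    4 * x              ≡⟨ split x ⟩
    x + 3 * x          ≤⟨ +-monoʳ-≤ x (*-monoʳ-≤ 3 x≤k) ⟩
    x + 3 * k          ≡⟨ regroup x k ⟩
    (x + k) + 2 * k    ≡⟨ cong (_+ 2 * k) (m∸n+n≡m k≤a) ⟩
    a + 2 * k          ≤⟨ a+2k≤w ⟩
    w                  ∎
    where
    x = a ∸ k
    x≤k : x ≤ k
    x≤k = excess≤k k a≤2k
    split : ∀ x → 4 * x ≡ x + 3 * x
    split = solve-∀
    regroup : ∀ x k → x + 3 * k ≡ (x + k) + 2 * k
    regroup = solve-∀

quarters-≤ : ∀ {x₁ x₂ x₃ x₄ w} → 4 * x₁ ≤ w → 4 * x₂ ≤ w → 4 * x₃ ≤ w → 4 * x₄ ≤ w →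
             x₁ + x₂ + x₃ + x₄ ≤ w
quarters-≤ {x₁} {x₂} {x₃} {x₄} {w} h₁ h₂ h₃ h₄ = *-cancelˡ-≤ 4 (begin
  4 * (x₁ + x₂ + x₃ + x₄)                   ≡⟨ distrib x₁ x₂ x₃ x₄ ⟩
  4 * x₁ + 4 * x₂ + 4 * x₃ + 4 * x₄         ≤⟨ +-mono-≤ (+-mono-≤ (+-mono-≤ h₁ h₂) h₃) h₄ ⟩
  w + w + w + w                             ≡⟨ four-times w ⟩
  4 * w                                     ∎)
  where
  distrib : ∀ a b c d → 4 * (a + b + c + d) ≡ 4 * a + 4 * b + 4 * c + 4 * d
  distrib = solve-∀
  four-times : ∀ w → w + w + w + w ≡ 4 * w
  four-times = solve-∀

pigeonhole-4 : ∀ x₁ x₂ x₃ x₄ w → x₁ + x₂ + x₃ + x₄ ≤ 4 * w →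
               x₁ ≤ w ⊎ x₂ ≤ w ⊎ x₃ ≤ w ⊎ x₄ ≤ w
pigeonhole-4 x₁ x₂ x₃ x₄ w sum≤ with x₁ ≤? w | x₂ ≤? w | x₃ ≤? w | x₄ ≤? w
... | yes h | _     | _     | _     = inj₁ h
... | no _  | yes h | _     | _     = inj₂ (inj₁ h)
... | no _  | no _  | yes h | _     = inj₂ (inj₂ (inj₁ h))
... | no _  | no _  | no _  | yes h = inj₂ (inj₂ (inj₂ h))
... | no h₁ | no h₂ | no h₃ | no h₄ = ⊥-elim (<⇒≱ (m<n+m (4 * w) {4} z<s) (begin
  4 + 4 * w                                 ≡⟨ four-succs w ⟩
  suc w + suc w + suc w + suc w
    ≤⟨ +-mono-≤ (+-mono-≤ (+-mono-≤ (≰⇒> h₁) (≰⇒> h₂)) (≰⇒> h₃)) (≰⇒> h₄) ⟩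
  x₁ + x₂ + x₃ + x₄                         ≤⟨ sum≤ ⟩
  4 * w                                     ∎))
  where
  four-succs : ∀ w → 4 + 4 * w ≡ suc w + suc w + suc w + suc w
  four-succs = solve-∀

excess-beside : ∀ {y a w} k → y + a ≤ w → y ∸ k ≤ w ∸ (a + k)
excess-beside {y} {a} {w} k y+a≤w =
  ≤-trans (∸-monoˡ-≤ k (m+n≤o⇒m≤o∸n y y+a≤w)) (≤-reflexive (∸-+-assoc w a k))

-- Over a light adjacent pair a, b the excesses of neighbours are thus bounded by the
-- "budget" 2(w ∸ (a + k)) + 2(w ∸ (b + k)) + 6((a ∸ k) + (b ∸ k)), which is at most 4w.
-- Half of it for a single light vertex z with z + k ≤ w is at most 2w.
light-budget : ∀ {z w} k → z ≤ 2 * k → z + k ≤ w → 2 * (w ∸ (z + k)) + 6 * (z ∸ k) ≤ 2 * w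
light-budget {z} {w} k z≤2k z+k≤w with k ≤? z
... | no k≰z = begin
  2 * (w ∸ (z + k)) + 6 * (z ∸ k)  ≡⟨ cong (λ t → 2 * (w ∸ (z + k)) + 6 * t) (m≤n⇒m∸n≡0 (<⇒≤ (≰⇒> k≰z))) ⟩
  2 * (w ∸ (z + k)) + 0            ≡⟨ +-identityʳ _ ⟩
  2 * (w ∸ (z + k))                ≤⟨ *-monoʳ-≤ 2 (m∸n≤m w (z + k)) ⟩
  2 * w                            ∎
... | yes k≤z = begin
  2 * r + 6 * α                    ≡⟨ split r α ⟩
  2 * r + 2 * α + 4 * α            ≤⟨ +-monoʳ-≤ (2 * r + 2 * α) (*-monoʳ-≤ 4 α≤k) ⟩
  2 * r + 2 * α + 4 * k            ≡⟨ regroup r α k ⟩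
  2 * (r + ((α + k) + k))          ≡⟨ cong (λ t → 2 * (r + (t + k))) (m∸n+n≡m k≤z) ⟩
  2 * (r + (z + k))                ≡⟨ cong (2 *_) (m∸n+n≡m z+k≤w) ⟩
  2 * w                            ∎
  where
  r = w ∸ (z + k)
  α = z ∸ k
  α≤k : α ≤ k
  α≤k = excess≤k k z≤2k
  split : ∀ r α → 2 * r + 6 * α ≡ 2 * r + 2 * α + 4 * α
  split = solve-∀
  regroup : ∀ r α k → 2 * r + 2 * α + 4 * k ≡ 2 * (r + ((α + k) + k))
  regroup = solve-∀

doubly-bounded-budget : ∀ {α w} k → α ≤ k → α ≤ w ∸ k → 2 * (w ∸ k) + 6 * α ≤ 4 * w
doubly-bounded-budget {α} {w} k α≤k α≤w∸k with k ≤? w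
... | no k≰w with n≤0⇒n≡0 (subst (α ≤_) (m≤n⇒m∸n≡0 (<⇒≤ (≰⇒> k≰w))) α≤w∸k)
...   | refl rewrite m≤n⇒m∸n≡0 (<⇒≤ (≰⇒> k≰w)) = z≤n
doubly-bounded-budget {α} {w} k α≤k α≤w∸k | yes k≤w = begin
  2 * W + 6 * α                    ≡⟨ split W α ⟩
  2 * W + 2 * α + 4 * α            ≤⟨ +-mono-≤ (+-monoʳ-≤ (2 * W) (*-monoʳ-≤ 2 α≤w∸k)) (*-monoʳ-≤ 4 α≤k) ⟩
  2 * W + 2 * W + 4 * k            ≡⟨ regroup W k ⟩
  4 * (W + k)                      ≡⟨ cong (4 *_) (m∸n+n≡m k≤w) ⟩
  4 * w                            ∎
  where
  W = w ∸ k
  split : ∀ W α → 2 * W + 6 * α ≡ 2 * W + 2 * α + 4 * α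
  split = solve-∀
  regroup : ∀ W k → 2 * W + 2 * W + 4 * k ≡ 4 * (W + k)
  regroup = solve-∀

-- If z + k exceeds w, the partner z' of z is below k and the budget is still at most 4w.
overfull-budget : ∀ {z z' w} k → z ≤ 2 * k → z + z' ≤ w → w < z + k →
  2 * (w ∸ (z + k)) + 2 * (w ∸ (z' + k)) + 6 * ((z ∸ k) + (z' ∸ k)) ≤ 4 * w
overfull-budget {z} {z'} {w} k z≤2k z+z'≤w w<z+k = begin
  2 * (w ∸ (z + k)) + 2 * (w ∸ (z' + k)) + 6 * ((z ∸ k) + (z' ∸ k))
    ≡⟨ cong₂ (λ s t → 2 * s + 2 * (w ∸ (z' + k)) + 6 * ((z ∸ k) + t)) s≡0 t≡0 ⟩
  2 * 0 + 2 * (w ∸ (z' + k)) + 6 * ((z ∸ k) + 0)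
    ≡⟨ cong₂ (λ s t → s + 6 * t) (+-identityˡ (2 * (w ∸ (z' + k)))) (+-identityʳ (z ∸ k)) ⟩
  2 * (w ∸ (z' + k)) + 6 * (z ∸ k)
    ≤⟨ +-monoˡ-≤ (6 * (z ∸ k)) (*-monoʳ-≤ 2 (∸-monoʳ-≤ w (m≤n+m k z'))) ⟩
  2 * (w ∸ k) + 6 * (z ∸ k)
    ≤⟨ doubly-bounded-budget k α≤k α≤w∸k ⟩
  4 * w ∎
  where
  s≡0 : w ∸ (z + k) ≡ 0
  s≡0 = m≤n⇒m∸n≡0 (<⇒≤ w<z+k)
  t≡0 : z' ∸ k ≡ 0
  t≡0 = m≤n⇒m∸n≡0 (<⇒≤ (+-cancelˡ-< z z' k (≤-<-trans z+z'≤w w<z+k)))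
  α≤k : z ∸ k ≤ k
  α≤k = excess≤k k z≤2k
  α≤w∸k : z ∸ k ≤ w ∸ k
  α≤w∸k = ∸-monoˡ-≤ k (≤-trans (m≤m+n z z') z+z'≤w)

pair-budget : ∀ {a b w} k → a ≤ 2 * k → b ≤ 2 * k → a + b ≤ w →
  2 * (w ∸ (a + k)) + 2 * (w ∸ (b + k)) + 6 * ((a ∸ k) + (b ∸ k)) ≤ 4 * w
pair-budget {a} {b} {w} k a≤2k b≤2k a+b≤w with a + k ≤? w | b + k ≤? w
... | no a+k≰w | _ = overfull-budget k a≤2k a+b≤w (≰⇒> a+k≰w)
... | yes _ | no b+k≰w = begin
  2 * (w ∸ (a + k)) + 2 * (w ∸ (b + k)) + 6 * ((a ∸ k) + (b ∸ k))
    ≡⟨ swap (w ∸ (a + k)) (w ∸ (b + k)) (a ∸ k) (b ∸ k) ⟩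
  2 * (w ∸ (b + k)) + 2 * (w ∸ (a + k)) + 6 * ((b ∸ k) + (a ∸ k))
    ≤⟨ overfull-budget k b≤2k (subst (_≤ w) (+-comm a b) a+b≤w) (≰⇒> b+k≰w) ⟩
  4 * w ∎
  where
  swap : ∀ r s α β → 2 * r + 2 * s + 6 * (α + β) ≡ 2 * s + 2 * r + 6 * (β + α)
  swap = solve-∀
... | yes a+k≤w | yes b+k≤w = begin
  2 * (w ∸ (a + k)) + 2 * (w ∸ (b + k)) + 6 * ((a ∸ k) + (b ∸ k))
    ≡⟨ regroup (w ∸ (a + k)) (w ∸ (b + k)) (a ∸ k) (b ∸ k) ⟩
  (2 * (w ∸ (a + k)) + 6 * (a ∸ k)) + (2 * (w ∸ (b + k)) + 6 * (b ∸ k))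
    ≤⟨ +-mono-≤ (light-budget k a≤2k a+k≤w) (light-budget k b≤2k b+k≤w) ⟩
  2 * w + 2 * w
    ≡⟨ double w ⟩
  4 * w ∎
  where
  regroup : ∀ r s α β → 2 * r + 2 * s + 6 * (α + β) ≡ (2 * r + 6 * α) + (2 * s + 6 * β)
  regroup = solve-∀
  double : ∀ w → 2 * w + 2 * w ≡ 4 * w
  double = solve-∀

matching-excess-≤ : ∀ {a b y₁ y₂ y₃ y₄ w} k → a ≤ 2 * k → b ≤ 2 * k → a + b ≤ w →
  y₁ + a ≤ w → y₂ + a ≤ w → y₃ + b ≤ w → y₄ + b ≤ w →
  (y₁ ∸ k) + (y₂ ∸ k) + (y₃ ∸ k) + (y₄ ∸ k) + 6 * ((a ∸ k) + (b ∸ k)) ≤ 4 * w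
matching-excess-≤ {a} {b} {y₁} {y₂} {y₃} {y₄} {w} k a≤2k b≤2k a+b≤w h₁ h₂ h₃ h₄ = begin
  (y₁ ∸ k) + (y₂ ∸ k) + (y₃ ∸ k) + (y₄ ∸ k) + 6 * ((a ∸ k) + (b ∸ k))
    ≤⟨ +-monoˡ-≤ (6 * ((a ∸ k) + (b ∸ k)))
         (+-mono-≤ (+-mono-≤ (+-mono-≤ (excess-beside k h₁) (excess-beside k h₂))
                             (excess-beside k h₃)) (excess-beside k h₄)) ⟩
  r + r + s + s + 6 * ((a ∸ k) + (b ∸ k))
    ≡⟨ regroup r s ((a ∸ k) + (b ∸ k)) ⟩
  2 * r + 2 * s + 6 * ((a ∸ k) + (b ∸ k))
    ≤⟨ pair-budget k a≤2k b≤2k a+b≤w ⟩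
  4 * w ∎
  where
  r = w ∸ (a + k)
  s = w ∸ (b + k)
  regroup : ∀ r s t → r + r + s + s + 6 * t ≡ 2 * r + 2 * s + 6 * t
  regroup = solve-∀

-- The Petersen graph is the Kneser graph K(5,2): its vertices are the 2-subsets
-- {lo v, hi v} of Fin 5, adjacent when disjoint.
data V : Set where
  v01 v02 v03 v04 v12 v13 v14 v23 v24 v34 : V

lo hi : V → Fin 5
lo v01 = 0F
lo v02 = 0F
lo v03 = 0F
lo v04 = 0F
lo v12 = 1F
lo v13 = 1F
lo v14 = 1F
lo v23 = 2F
lo v24 = 2F
lo v34 = 3F
hi v01 = 1F
hi v02 = 2F
hi v03 = 3F
hi v04 = 4F
hi v12 = 2F
hi v13 = 3F
hi v14 = 4F
hi v23 = 3F
hi v24 = 4F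
hi v34 = 4F

-- The vertex {i, j}; on the diagonal i = j, which is not a 2-subset, its value is arbitrary.
pairV : Fin 5 → Fin 5 → V
pairV 0F 1F = v01
pairV 0F 2F = v02
pairV 0F 3F = v03
pairV 0F 4F = v04
pairV 1F 0F = v01
pairV 1F 2F = v12
pairV 1F 3F = v13
pairV 1F 4F = v14
pairV 2F 0F = v02
pairV 2F 1F = v12
pairV 2F 3F = v23
pairV 2F 4F = v24
pairV 3F 0F = v03
pairV 3F 1F = v13
pairV 3F 2F = v23
pairV 3F 4F = v34
pairV 4F 0F = v04
pairV 4F 1F = v14
pairV 4F 2F = v24
pairV 4F 3F = v34
pairV _  _  = v01

pairV-lo-hi : ∀ v → pairV (lo v) (hi v) ≡ v
pairV-lo-hi v01 = refl
pairV-lo-hi v02 = refl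
pairV-lo-hi v03 = refl
pairV-lo-hi v04 = refl
pairV-lo-hi v12 = refl
pairV-lo-hi v13 = refl
pairV-lo-hi v14 = refl
pairV-lo-hi v23 = refl
pairV-lo-hi v24 = refl
pairV-lo-hi v34 = refl

_≟V_ : (u v : V) → Dec (u ≡ v)
u ≟V v = map′ same-elements (λ u≡v → cong lo u≡v , cong hi u≡v) (lo u ≟ lo v ×-dec hi u ≟ hi v)
  where
  same-elements : lo u ≡ lo v × hi u ≡ hi v → u ≡ v
  same-elements (l , h) = trans (sym (pairV-lo-hi u)) (trans (cong₂ pairV l h) (pairV-lo-hi v))

∀V? : {P : V → Set} → (∀ v → Dec (P v)) → Dec (∀ v → P v)
∀V? {P} P? = map′ (λ h v → subst P (pairV-lo-hi v) (h (lo v) (hi v))) (λ h i j → h (pairV i j))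
                  (all? λ i → all? λ j → P? (pairV i j))

∃V? : {P : V → Set} → (∀ v → Dec (P v)) → Dec (Σ V P)
∃V? {P} P? = map′ (λ { (i , j , p) → pairV i j , p })
                  (λ { (v , p) → lo v , hi v , subst P (sym (pairV-lo-hi v)) p })
                  (any? λ i → any? λ j → P? (pairV i j))

Disjoint : {A : Set} → A → A → A → A → Set
Disjoint a b c d = a ≢ c × a ≢ d × b ≢ c × b ≢ d

Adjacent : V → V → Set
Adjacent u v = Disjoint (lo u) (hi u) (lo v) (hi v)

adjacent? : ∀ u v → Dec (Adjacent u v)
adjacent? u v = ¬? (lo u ≟ lo v) ×-dec ¬? (lo u ≟ hi v) ×-dec ¬? (hi u ≟ lo v) ×-dec ¬? (hi u ≟ hi v)

adjacent-irreflexive : ∀ {v} → ¬ Adjacent v v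
adjacent-irreflexive (lo≢lo , _) = lo≢lo refl

adjacent-sym : ∀ {u v} → Adjacent u v → Adjacent v u
adjacent-sym (a , b , c , d) = (λ e → a (sym e)) , (λ e → c (sym e)) , (λ e → b (sym e)) , (λ e → d (sym e))

lo≢hi : ∀ v → lo v ≢ hi v
lo≢hi = from-yes (∀V? λ v → ¬? (lo v ≟ hi v))

pairV-sym : ∀ i j → pairV i j ≡ pairV j i
pairV-sym = from-yes (all? λ i → all? λ j → pairV i j ≟V pairV j i)

pairV-elements : ∀ i j → i ≢ j →
  (lo (pairV i j) ≡ i × hi (pairV i j) ≡ j) ⊎ (lo (pairV i j) ≡ j × hi (pairV i j) ≡ i)
pairV-elements = from-yes (all? λ i → all? λ j → ¬? (i ≟ j) →-dec
  ((lo (pairV i j) ≟ i ×-dec hi (pairV i j) ≟ j) ⊎-dec (lo (pairV i j) ≟ j ×-dec hi (pairV i j) ≟ i)))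

pairV-sorted : ∀ i j → i Fin.< j → lo (pairV i j) ≡ i × hi (pairV i j) ≡ j
pairV-sorted = from-yes (all? λ i → all? λ j → i <ᶠ? j →-dec (lo (pairV i j) ≟ i ×-dec hi (pairV i j) ≟ j))

disjoint-subst : {A : Set} {a b c d a' b' c' d' : A} → a ≡ a' → b ≡ b' → c ≡ c' → d ≡ d' →
                 Disjoint a b c d → Disjoint a' b' c' d'
disjoint-subst refl refl refl refl D = D

disjoint-swapˡ : {A : Set} {a b c d : A} → Disjoint a b c d → Disjoint b a c d
disjoint-swapˡ (ac , ad , bc , bd) = bc , bd , ac , ad

disjoint-swapʳ : {A : Set} {a b c d : A} → Disjoint a b c d → Disjoint a b d c
disjoint-swapʳ (ac , ad , bc , bd) = ad , ac , bd , bc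

disjoint-map : {A B : Set} (f : A → B) → (∀ {x y} → f x ≡ f y → x ≡ y) →
               {a b c d : A} → Disjoint a b c d → Disjoint (f a) (f b) (f c) (f d)
disjoint-map f inj (ac , ad , bc , bd) =
  (λ e → ac (inj e)) , (λ e → ad (inj e)) , (λ e → bc (inj e)) , (λ e → bd (inj e))

pairV-adjacent : ∀ {a b c d} → a ≢ b → c ≢ d → Disjoint a b c d → Adjacent (pairV a b) (pairV c d)
pairV-adjacent {a} {b} {c} {d} a≢b c≢d D with pairV-elements a b a≢b | pairV-elements c d c≢d
... | inj₁ (l , h) | inj₁ (l' , h') = disjoint-subst (sym l) (sym h) (sym l') (sym h') D
... | inj₁ (l , h) | inj₂ (l' , h') = disjoint-subst (sym l) (sym h) (sym l') (sym h') (disjoint-swapʳ D)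
... | inj₂ (l , h) | inj₁ (l' , h') = disjoint-subst (sym l) (sym h) (sym l') (sym h') (disjoint-swapˡ D)
... | inj₂ (l , h) | inj₂ (l' , h') =
  disjoint-subst (sym l) (sym h) (sym l') (sym h') (disjoint-swapˡ (disjoint-swapʳ D))

pairV-map : ∀ (f : Fin 5 → Fin 5) {x y} → x ≢ y →
            pairV (f (lo (pairV x y))) (f (hi (pairV x y))) ≡ pairV (f x) (f y)
pairV-map f {x} {y} x≢y with pairV-elements x y x≢y
... | inj₁ (l , h) = cong₂ (λ s t → pairV (f s) (f t)) l h
... | inj₂ (l , h) = trans (cong₂ (λ s t → pairV (f s) (f t)) l h) (pairV-sym (f y) (f x))

toV : PVertex → V
toV ((i , j) , _) = pairV i j

toV-elements : ∀ p → lo (toV p) ≡ proj₁ (proj₁ p) × hi (toV p) ≡ proj₂ (proj₁ p)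
toV-elements ((i , j) , i<j) = pairV-sorted i j i<j

toV-injective : ∀ {p q} → toV p ≡ toV q → p ≡ q
toV-injective {(i , j) , i<j} {(k , l) , k<l} e = same (lo-same) (hi-same)
  where
  lo-same : i ≡ k
  lo-same = trans (sym (proj₁ (pairV-sorted i j i<j))) (trans (cong lo e) (proj₁ (pairV-sorted k l k<l)))
  hi-same : j ≡ l
  hi-same = trans (sym (proj₂ (pairV-sorted i j i<j))) (trans (cong hi e) (proj₂ (pairV-sorted k l k<l)))
  same : i ≡ k → j ≡ l → ((i , j) , i<j) ≡ ((k , l) , k<l)
  same refl refl = cong ((i , j) ,_) (<-irrelevant i<j k<l)

toV-adjacent : ∀ p q → PAdj p q → Adjacent (toV p) (toV q)
toV-adjacent p q = disjoint-subst (sym lp) (sym hp) (sym lq) (sym hq)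
  where
  lp = proj₁ (toV-elements p)
  hp = proj₂ (toV-elements p)
  lq = proj₁ (toV-elements q)
  hq = proj₂ (toV-elements q)

adjacent-toV : ∀ p q → Adjacent (toV p) (toV q) → PAdj p q
adjacent-toV p q = disjoint-subst lp hp lq hq
  where
  lp = proj₁ (toV-elements p)
  hp = proj₂ (toV-elements p)
  lq = proj₁ (toV-elements q)
  hq = proj₂ (toV-elements q)

act : Permutation′ 5 → V → V
act π v = pairV (π ⟨$⟩ʳ lo v) (π ⟨$⟩ʳ hi v)

⟨$⟩ʳ-injective : ∀ (π : Permutation′ 5) {x y} → π ⟨$⟩ʳ x ≡ π ⟨$⟩ʳ y → x ≡ y
⟨$⟩ʳ-injective π {x} {y} e = trans (sym (inverseˡ π)) (trans (cong (π ⟨$⟩ˡ_) e) (inverseˡ π))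

act-adjacent : ∀ π {u v} → Adjacent u v → Adjacent (act π u) (act π v)
act-adjacent π {u} {v} A =
  pairV-adjacent (λ e → lo≢hi u (⟨$⟩ʳ-injective π e)) (λ e → lo≢hi v (⟨$⟩ʳ-injective π e))
                 (disjoint-map (π ⟨$⟩ʳ_) (⟨$⟩ʳ-injective π) A)

act-∘ : ∀ π σ v → act σ (act π v) ≡ act (π ∘ₚ σ) v
act-∘ π σ v = pairV-map (σ ⟨$⟩ʳ_) (λ e → lo≢hi v (⟨$⟩ʳ-injective π e))

act-inverse : ∀ π v → act π (act (flip π) v) ≡ v
act-inverse π v = trans (act-∘ (flip π) π v)
  (trans (cong₂ pairV (inverseʳ π) (inverseʳ π)) (pairV-lo-hi v))

EdgeBound : (V → ℕ) → ℕ → Set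
EdgeBound n w = ∀ u v → Adjacent u v → n u + n v ≤ w

edge-bound-act : ∀ {n w} π → EdgeBound n w → EdgeBound (λ v → n (act π v)) w
edge-bound-act π edge u v adj = edge (act π u) (act π v) (act-adjacent π adj)

-- A colouring of the blowup of the Petersen graph whose part at v is a clique of
-- size m v, with c colours: the i-th vertex of the part v gets colour  colour v i.
record WeightedColouring (m : V → ℕ) (c : ℕ) : Set where
  field
    colour    : V → ℕ → ℕ
    bounded   : ∀ v {i} → i < m v → colour v i < c
    injective : ∀ v {i j} → i < m v → j < m v → colour v i ≡ colour v j → i ≡ j
    proper    : ∀ {u v} → Adjacent u v → ∀ {i j} → i < m u → j < m v → colour u i ≢ colour v j

pullback : ∀ π {m c} → WeightedColouring (λ v → m (act π v)) c → WeightedColouring m c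
pullback π {m} {c} χ = record
  { colour    = λ v → colour (act (flip π) v)
  ; bounded   = λ v i<m → bounded _ (back v i<m)
  ; injective = λ v i<m j<m → injective _ (back v i<m) (back v j<m)
  ; proper    = λ adj i<m j<m → proper (act-adjacent (flip π) adj) (back _ i<m) (back _ j<m)
  }
  where
  open WeightedColouring χ
  back : ∀ v {i} → i < m v → i < m (act π (act (flip π) v))
  back v = subst (_ <_) (sym (cong m (act-inverse π v)))

Interval : Set
Interval = ℕ × ℕ

_∈ᵢ_ : ℕ → Interval → Set
x ∈ᵢ (s , l) = s ≤ x × x < s + l

Separated : Interval → Interval → Set
Separated (s , l) (s' , l') = s + l ≤ s' ⊎ s' + l' ≤ s

EndsBy : ℕ → Interval → Set
EndsBy top (s , l) = s + l ≤ top

size : List Interval → ℕ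
size []             = 0
size ((_ , l) ∷ Is) = l + size Is

enumerate : List Interval → ℕ → ℕ
enumerate []             i = 0
enumerate ((s , l) ∷ Is) i with i <? l
... | yes _ = s + i
... | no  _ = enumerate Is (i ∸ l)

index-rest : ∀ {i l n} → ¬ i < l → i < l + n → i ∸ l < n
index-rest {i} {l} {n} i≮l i<l+n =
  +-cancelˡ-< l (i ∸ l) n (subst (_< l + n) (sym (m+[n∸m]≡n (≮⇒≥ i≮l))) i<l+n)

enumerate-∈ : ∀ Is {i} → i < size Is → Any (enumerate Is i ∈ᵢ_) Is
enumerate-∈ ((s , l) ∷ Is) {i} i<size with i <? l
... | yes i<l = here (m≤m+n s i , +-monoʳ-< s i<l)
... | no  i≮l = there (enumerate-∈ Is (index-rest i≮l i<size))

separated-≢ : ∀ {x y} I J → x ∈ᵢ I → y ∈ᵢ J → Separated I J → x ≢ y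
separated-≢ _ _ (_ , x<) (y≥ , _) (inj₁ I≤J) refl = <-irrefl refl (<-≤-trans x< (≤-trans I≤J y≥))
separated-≢ _ _ (x≥ , _) (_ , y<) (inj₂ J≤I) refl = <-irrefl refl (<-≤-trans y< (≤-trans J≤I x≥))

separated-from-all : ∀ {x y} I Js → All (Separated I) Js → x ∈ᵢ I → Any (y ∈ᵢ_) Js → x ≢ y
separated-from-all I (J ∷ _)  (sep ∷ _)    x∈I (here y∈J)  = separated-≢ I J x∈I y∈J sep
separated-from-all I (_ ∷ Js) (_   ∷ seps) x∈I (there y∈Js) = separated-from-all I Js seps x∈I y∈Js

separated-lists : ∀ {x y} Is Js → All (λ I → All (Separated I) Js) Is →
                  Any (x ∈ᵢ_) Is → Any (y ∈ᵢ_) Js → x ≢ y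
separated-lists (I ∷ _)  Js (seps ∷ _) (here x∈I)   y∈Js = separated-from-all I Js seps x∈I y∈Js
separated-lists (_ ∷ Is) Js (_ ∷ sepss) (there x∈Is) y∈Js = separated-lists Is Js sepss x∈Is y∈Js

enumerate-injective : ∀ Is → AllPairs Separated Is → ∀ {i j} → i < size Is → j < size Is →
                      enumerate Is i ≡ enumerate Is j → i ≡ j
enumerate-injective ((s , l) ∷ Is) (seps ∷ sepss) {i} {j} i<size j<size eq with i <? l | j <? l
... | yes _   | yes _   = +-cancelˡ-≡ s i j eq
... | yes i<l | no  j≮l = ⊥-elim (separated-from-all (s , l) Is seps (m≤m+n s i , +-monoʳ-< s i<l)
                            (enumerate-∈ Is (index-rest j≮l j<size)) eq)
... | no  i≮l | yes j<l = ⊥-elim (separated-from-all (s , l) Is seps (m≤m+n s j , +-monoʳ-< s j<l)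
                            (enumerate-∈ Is (index-rest i≮l i<size)) (sym eq))
... | no  i≮l | no  j≮l = ∸-cancelʳ-≡ (≮⇒≥ i≮l) (≮⇒≥ j≮l)
                            (enumerate-injective Is sepss (index-rest i≮l i<size) (index-rest j≮l j<size) eq)

enumerate-bounded : ∀ {top} Is → All (EndsBy top) Is → ∀ {i} → i < size Is → enumerate Is i < top
enumerate-bounded Is ends i<size = below Is ends (enumerate-∈ Is i<size)
  where
  below : ∀ {top x} Is → All (EndsBy top) Is → Any (x ∈ᵢ_) Is → x < top
  below (_ ∷ _)  (end ∷ _)    (here (_ , x<)) = <-≤-trans x< end
  below (_ ∷ Is) (_ ∷ ends)   (there x∈Is)   = below Is ends x∈Is

-- The symbolic intervals of the layout: seg 0 holds k colours shared by the whole
-- star of 0, seg i (i = 1..4) the excess colours of {0,i}; low j and high j hold the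
-- colours that the two vertices of the j-th matched pair do not take from the star.
data Slot : Set where
  seg  : Fin 5 → Slot
  low  : Fin 3 → Slot
  high : Fin 3 → Slot

-- Slots whose intervals never overlap, whatever the weights.
data Apart : Slot → Slot → Set where
  seg-seg  : ∀ {i j} → i ≢ j → Apart (seg i) (seg j)
  seg-low  : ∀ {i j} → Apart (seg i) (low j)
  low-seg  : ∀ {i j} → Apart (low i) (seg j)
  seg-high : ∀ {i j} → Apart (seg i) (high j)
  high-seg : ∀ {i j} → Apart (high i) (seg j)
  low-high : ∀ {j} → Apart (low j) (high j)
  high-low : ∀ {j} → Apart (high j) (low j)

apart? : ∀ s t → Dec (Apart s t)
apart? (seg i)  (seg j)  = map′ seg-seg (λ { (seg-seg i≢j) → i≢j }) (¬? (i ≟ j))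
apart? (seg _)  (low _)  = yes seg-low
apart? (seg _)  (high _) = yes seg-high
apart? (low _)  (seg _)  = yes low-seg
apart? (high _) (seg _)  = yes high-seg
apart? (low i)  (high j) = map′ (λ { refl → low-high }) (λ { low-high → refl }) (i ≟ j)
apart? (high i) (low j)  = map′ (λ { refl → high-low }) (λ { high-low → refl }) (i ≟ j)
apart? (low _)  (low _)  = no λ ()
apart? (high _) (high _) = no λ ()

-- The slots of each vertex. The matched pairs are ({1,2},{3,4}), ({1,3},{2,4}) and
-- ({1,4},{2,3}); each of their vertices reuses the excess colours of the two star
-- vertices it meets.
slots : V → List Slot
slots v01 = seg 0F ∷ seg 1F ∷ []
slots v02 = seg 0F ∷ seg 2F ∷ []
slots v03 = seg 0F ∷ seg 3F ∷ []
slots v04 = seg 0F ∷ seg 4F ∷ []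
slots v12 = seg 1F ∷ seg 2F ∷ low 0F ∷ []
slots v13 = seg 1F ∷ seg 3F ∷ low 1F ∷ []
slots v14 = seg 1F ∷ seg 4F ∷ low 2F ∷ []
slots v34 = seg 3F ∷ seg 4F ∷ high 0F ∷ []
slots v24 = seg 2F ∷ seg 4F ∷ high 1F ∷ []
slots v23 = seg 2F ∷ seg 3F ∷ high 2F ∷ []

slots-apart : ∀ v → AllPairs Apart (slots v)
slots-apart = from-yes (∀V? λ v → allPairs? apart? (slots v))

slots-apart-adjacent : ∀ u v → Adjacent u v → All (λ s → All (Apart s) (slots v)) (slots u)
slots-apart-adjacent = from-yes (∀V? λ u → ∀V? λ v →
  adjacent? u v →-dec All.all? (λ s → All.all? (apart? s) (slots v)) (slots u))

-- Prefix sums of a sequence of lengths: segment i occupies [offset ℓ i, offset ℓ (suc i)).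
offset : (ℕ → ℕ) → ℕ → ℕ
offset ℓ zero    = 0
offset ℓ (suc i) = offset ℓ i + ℓ i

offset-mono : ∀ ℓ {i j} → i ≤ j → offset ℓ i ≤ offset ℓ j
offset-mono ℓ {i} {zero}  z≤n  = ≤-refl
offset-mono ℓ {i} {suc j} i≤j+1 with m≤n⇒m<n∨m≡n i≤j+1
... | inj₂ refl        = ≤-refl
... | inj₁ (s≤s i≤j) = ≤-trans (offset-mono ℓ i≤j) (m≤m+n (offset ℓ j) (ℓ j))

-- The star of 0 is admissible when its total excess over k is at most w and at most
-- one of its vertices is heavy (above 2k), i.e. of any two one is light. Stated on the
-- four star weights, so that it transports along pointwise equal weights.
record StarAdmissible (k w s₁ s₂ s₃ s₄ : ℕ) : Set where
  constructor admissible
  field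
    excess-≤ : (s₁ ∸ k) + (s₂ ∸ k) + (s₃ ∸ k) + (s₄ ∸ k) ≤ w
    light₁₂  : s₁ ≤ 2 * k ⊎ s₂ ≤ 2 * k
    light₁₃  : s₁ ≤ 2 * k ⊎ s₃ ≤ 2 * k
    light₁₄  : s₁ ≤ 2 * k ⊎ s₄ ≤ 2 * k
    light₂₃  : s₂ ≤ 2 * k ⊎ s₃ ≤ 2 * k
    light₂₄  : s₂ ≤ 2 * k ⊎ s₄ ≤ 2 * k
    light₃₄  : s₃ ≤ 2 * k ⊎ s₄ ≤ 2 * k

Admissible : (V → ℕ) → ℕ → ℕ → Set
Admissible m k w = StarAdmissible k w (m v01) (m v02) (m v03) (m v04)

admissible-cong : ∀ {m m' k w} → (∀ v → m v ≡ m' v) → Admissible m k w → Admissible m' k w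
admissible-cong {m} {m'} eq = transport (eq v01) (eq v02) (eq v03) (eq v04)
  where
  transport : ∀ {k w s₁ s₂ s₃ s₄ t₁ t₂ t₃ t₄} → s₁ ≡ t₁ → s₂ ≡ t₂ → s₃ ≡ t₃ → s₄ ≡ t₄ →
              StarAdmissible k w s₁ s₂ s₃ s₄ → StarAdmissible k w t₁ t₂ t₃ t₄
  transport refl refl refl refl A = A

module _ {k w s₁ s₂ s₃ s₄ : ℕ} (excess-≤ : (s₁ ∸ k) + (s₂ ∸ k) + (s₃ ∸ k) + (s₄ ∸ k) ≤ w) where
  light-but₁ : s₂ ≤ 2 * k → s₃ ≤ 2 * k → s₄ ≤ 2 * k → StarAdmissible k w s₁ s₂ s₃ s₄
  light-but₁ l₂ l₃ l₄ = admissible excess-≤ (inj₂ l₂) (inj₂ l₃) (inj₂ l₄) (inj₁ l₂) (inj₁ l₂) (inj₁ l₃)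

  light-but₂ : s₁ ≤ 2 * k → s₃ ≤ 2 * k → s₄ ≤ 2 * k → StarAdmissible k w s₁ s₂ s₃ s₄
  light-but₂ l₁ l₃ l₄ = admissible excess-≤ (inj₁ l₁) (inj₁ l₁) (inj₁ l₁) (inj₂ l₃) (inj₂ l₄) (inj₁ l₃)

  light-but₃ : s₁ ≤ 2 * k → s₂ ≤ 2 * k → s₄ ≤ 2 * k → StarAdmissible k w s₁ s₂ s₃ s₄
  light-but₃ l₁ l₂ l₄ = admissible excess-≤ (inj₁ l₁) (inj₁ l₁) (inj₁ l₁) (inj₁ l₂) (inj₁ l₂) (inj₂ l₄)

  light-but₄ : s₁ ≤ 2 * k → s₂ ≤ 2 * k → s₃ ≤ 2 * k → StarAdmissible k w s₁ s₂ s₃ s₄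
  light-but₄ l₁ l₂ l₃ = admissible excess-≤ (inj₁ l₁) (inj₁ l₁) (inj₁ l₁) (inj₁ l₂) (inj₁ l₂) (inj₁ l₃)

module StarLayout {m : V → ℕ} {k w : ℕ} (edge : EdgeBound m w) (adm : Admissible m k w) where
  open StarAdmissible adm

  len : ℕ → ℕ
  len 0 = k
  len 1 = m v01 ∸ k
  len 2 = m v02 ∸ k
  len 3 = m v03 ∸ k
  len 4 = m v04 ∸ k
  len _ = 0

  excess : ℕ
  excess = len 1 + len 2 + len 3 + len 4

  -- The first colour not used by the star, and the number of colours.
  free top : ℕ
  free = offset len 5
  top  = k + w

  free≡ : free ≡ k + excess
  free≡ = regroup k (len 1) (len 2) (len 3) (len 4)
    where
    regroup : ∀ a b c d e → 0 + a + b + c + d + e ≡ a + (b + c + d + e)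
    regroup = solve-∀

  -- What the vertices of the j-th matched pair need beyond the two reused segments.
  lowExtra highExtra : Fin 3 → ℕ
  lowExtra 0F  = m v12 ∸ (len 1 + len 2)
  lowExtra 1F  = m v13 ∸ (len 1 + len 3)
  lowExtra 2F  = m v14 ∸ (len 1 + len 4)
  highExtra 0F = m v34 ∸ (len 3 + len 4)
  highExtra 1F = m v24 ∸ (len 2 + len 4)
  highExtra 2F = m v23 ∸ (len 2 + len 3)

  interval : Slot → Interval
  interval (seg i)  = offset len (toℕ i) , len (toℕ i)
  interval (low j)  = free , lowExtra j
  interval (high j) = top ∸ highExtra j , highExtra j

  matched-fits : ∀ {L H P Q} → P + Q ≡ excess → L + H ≤ w → L + Q ≤ w → P + H ≤ w →
                 free + (L ∸ P) + (H ∸ Q) ≤ top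
  matched-fits {L} {H} {P} {Q} P+Q≡ LH LQ PH = begin
    free + (L ∸ P) + (H ∸ Q)             ≡⟨ cong (λ t → t + (L ∸ P) + (H ∸ Q)) free≡ ⟩
    k + excess + (L ∸ P) + (H ∸ Q)       ≡⟨ regroup k excess (L ∸ P) (H ∸ Q) ⟩
    k + ((L ∸ P) + (H ∸ Q) + excess)     ≡⟨ cong (λ t → k + ((L ∸ P) + (H ∸ Q) + t)) (sym P+Q≡) ⟩
    k + ((L ∸ P) + (H ∸ Q) + (P + Q))    ≤⟨ +-monoʳ-≤ k (top-up-≤ {L} {H} {P} {Q} LH LQ PH P+Q≤w) ⟩
    top                                  ∎
    where
    P+Q≤w : P + Q ≤ w
    P+Q≤w = subst (_≤ w) (sym P+Q≡) excess-≤
    regroup : ∀ k x a b → k + x + a + b ≡ k + (a + b + x)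
    regroup = solve-∀

  edge! : ∀ u v → {True (adjacent? u v)} → m u + m v ≤ w
  edge! u v {t} = edge u v (toWitness t)

  room : ∀ x y z → {True (adjacent? x y)} → {True (adjacent? x z)} → m y ≤ 2 * k ⊎ m z ≤ 2 * k →
         m x + ((m y ∸ k) + (m z ∸ k)) ≤ w
  room x y z {xy} {xz} light =
    room-for-excesses {m x} {m y} {m z} k (edge! x y {xy}) (edge! x z {xz}) light

  matched : ∀ j → free + lowExtra j + highExtra j ≤ top
  matched 0F = matched-fits {m v12} {m v34} {len 1 + len 2} {len 3 + len 4}
    (split (len 1) (len 2) (len 3) (len 4)) (edge! v12 v34)
    (room v12 v03 v04 light₃₄)
    (subst (_≤ w) (+-comm (m v34) _) (room v34 v01 v02 light₁₂))
    where
    split : ∀ a b c d → a + b + (c + d) ≡ a + b + c + d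
    split = solve-∀
  matched 1F = matched-fits {m v13} {m v24} {len 1 + len 3} {len 2 + len 4}
    (split (len 1) (len 2) (len 3) (len 4)) (edge! v13 v24)
    (room v13 v02 v04 light₂₄)
    (subst (_≤ w) (+-comm (m v24) _) (room v24 v01 v03 light₁₃))
    where
    split : ∀ a b c d → a + c + (b + d) ≡ a + b + c + d
    split = solve-∀
  matched 2F = matched-fits {m v14} {m v23} {len 1 + len 4} {len 2 + len 3}
    (split (len 1) (len 2) (len 3) (len 4)) (edge! v14 v23)
    (room v14 v02 v03 light₂₃)
    (subst (_≤ w) (+-comm (m v23) _) (room v23 v01 v04 light₁₄))
    where
    split : ∀ a b c d → a + d + (b + c) ≡ a + b + c + d
    split = solve-∀

  free≤top : free ≤ top
  free≤top = subst (_≤ top) (sym free≡) (+-monoʳ-≤ k excess-≤)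

  seg-ends : ∀ i → offset len (toℕ i) + len (toℕ i) ≤ free
  seg-ends i = offset-mono len {suc (toℕ i)} {5} (toℕ<n i)

  -- The high blocks fit below the top, as each high vertex is adjacent to {0,1}.
  cut-below-top : ∀ x d → x + m v01 ≤ w → x ∸ d ≤ top
  cut-below-top x d x+m≤w = ≤-trans (m∸n≤m x d) (≤-trans (≤-trans (m≤m+n x _) x+m≤w) (m≤n+m w k))

  highExtra≤top : ∀ j → highExtra j ≤ top
  highExtra≤top 0F = cut-below-top (m v34) (len 3 + len 4) (edge! v34 v01)
  highExtra≤top 1F = cut-below-top (m v24) (len 2 + len 4) (edge! v24 v01)
  highExtra≤top 2F = cut-below-top (m v23) (len 2 + len 3) (edge! v23 v01)

  free≤high : ∀ j → free ≤ top ∸ highExtra j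
  free≤high j =
    m+n≤o⇒m≤o∸n free (≤-trans (+-monoˡ-≤ (highExtra j) (m≤m+n free (lowExtra j))) (matched j))

  ends : ∀ s → EndsBy top (interval s)
  ends (seg i)  = ≤-trans (seg-ends i) free≤top
  ends (low j)  = ≤-trans (m≤m+n (free + lowExtra j) (highExtra j)) (matched j)
  ends (high j) = ≤-reflexive (m∸n+n≡m (highExtra≤top j))

  separated : ∀ {s t} → Apart s t → Separated (interval s) (interval t)
  separated (seg-seg {i} {j} i≢j) with <-cmp (toℕ i) (toℕ j)
  ... | tri< i<j _ _ = inj₁ (offset-mono len i<j)
  ... | tri≈ _ i≡j _ = ⊥-elim (i≢j (toℕ-injective i≡j))
  ... | tri> _ _ j<i = inj₂ (offset-mono len j<i)
  separated (seg-low {i})      = inj₁ (seg-ends i)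
  separated (low-seg {_} {j})  = inj₂ (seg-ends j)
  separated (seg-high {i} {j}) = inj₁ (≤-trans (seg-ends i) (free≤high j))
  separated (high-seg {i} {j}) = inj₂ (≤-trans (seg-ends j) (free≤high i))
  separated (low-high {j})     = inj₁ (m+n≤o⇒m≤o∸n (free + lowExtra j) (matched j))
  separated (high-low {j})     = inj₂ (m+n≤o⇒m≤o∸n (free + lowExtra j) (matched j))

  intervals : V → List Interval
  intervals v = map interval (slots v)

  -- Each vertex gets at least as many colours as its weight: a star vertex has k shared
  -- colours plus its excess, a pair vertex its two reused segments plus its extras.
  star-covers : ∀ x → x ≤ k + ((x ∸ k) + 0)
  star-covers x = subst (x ≤_) (cong (k +_) (sym (+-identityʳ (x ∸ k)))) (m≤n+m∸n x k)

  pair-covers : ∀ x a b → x ≤ a + (b + ((x ∸ (a + b)) + 0))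
  pair-covers x a b = subst (x ≤_) (regroup a b (x ∸ (a + b))) (m≤n+m∸n x (a + b))
    where
    regroup : ∀ a b c → a + b + c ≡ a + (b + (c + 0))
    regroup = solve-∀

  covers : ∀ v → m v ≤ size (intervals v)
  covers v01 = star-covers (m v01)
  covers v02 = star-covers (m v02)
  covers v03 = star-covers (m v03)
  covers v04 = star-covers (m v04)
  covers v12 = pair-covers (m v12) (len 1) (len 2)
  covers v13 = pair-covers (m v13) (len 1) (len 3)
  covers v14 = pair-covers (m v14) (len 1) (len 4)
  covers v34 = pair-covers (m v34) (len 3) (len 4)
  covers v24 = pair-covers (m v24) (len 2) (len 4)
  covers v23 = pair-covers (m v23) (len 2) (len 3)

  colouring : WeightedColouring m top
  colouring = record
    { colour    = λ v → enumerate (intervals v)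
    ; bounded   = λ v i<m → enumerate-bounded (intervals v) (All.map⁺ (All.tabulate λ {s} _ → ends s))
                              (<-≤-trans i<m (covers v))
    ; injective = λ v i<m j<m → enumerate-injective (intervals v)
                    (AllPairs.map⁺ (AllPairs.map separated (slots-apart v)))
                    (<-≤-trans i<m (covers v)) (<-≤-trans j<m (covers v))
    ; proper    = λ {u} {v} adj i<m j<m → separated-lists (intervals u) (intervals v)
                    (All.map⁺ (All.map (λ apart → All.map⁺ (All.map separated apart))
                                       (slots-apart-adjacent u v adj)))
                    (enumerate-∈ (intervals u) (<-≤-trans i<m (covers u)))
                    (enumerate-∈ (intervals v) (<-≤-trans j<m (covers v)))
    }

Avoids : Fin 5 → V → Set
Avoids a v = lo v ≢ a × hi v ≢ a

avoids? : ∀ a v → Dec (Avoids a v)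
avoids? a v = ¬? (lo v ≟ a) ×-dec ¬? (hi v ≟ a)

not-disjoint : ∀ {a b c d : Fin 5} → ¬ Disjoint a b c d → a ≡ c ⊎ a ≡ d ⊎ b ≡ c ⊎ b ≡ d
not-disjoint {a} {b} {c} {d} nd with a ≟ c | a ≟ d | b ≟ c | b ≟ d
... | yes e | _     | _     | _     = inj₁ e
... | no _  | yes e | _     | _     = inj₂ (inj₁ e)
... | no _  | no _  | yes e | _     = inj₂ (inj₂ (inj₁ e))
... | no _  | no _  | no _  | yes e = inj₂ (inj₂ (inj₂ e))
... | no ac | no ad | no bc | no bd = ⊥-elim (nd (ac , ad , bc , bd))

meets-other : ∀ {a b} v → ¬ Disjoint a b (lo v) (hi v) → Avoids a v →
              Σ (Fin 5) λ c → c ≢ a × c ≢ b × v ≡ pairV b c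
meets-other {a} {b} v nd (lo≢a , hi≢a) with not-disjoint nd
... | inj₁ a≡lo               = ⊥-elim (lo≢a (sym a≡lo))
... | inj₂ (inj₁ a≡hi)        = ⊥-elim (hi≢a (sym a≡hi))
... | inj₂ (inj₂ (inj₁ b≡lo)) =
  hi v , hi≢a , (λ hi≡b → lo≢hi v (trans (sym b≡lo) (sym hi≡b))) ,
  trans (sym (pairV-lo-hi v)) (cong (λ x → pairV x (hi v)) (sym b≡lo))
... | inj₂ (inj₂ (inj₂ b≡hi)) =
  lo v , lo≢a , (λ lo≡b → lo≢hi v (trans lo≡b b≡hi)) ,
  trans (sym (pairV-lo-hi v)) (trans (pairV-sym (lo v) (hi v)) (cong (λ x → pairV x (lo v)) (sym b≡hi)))

-- A family of pairwise intersecting 2-subsets of a 5-set either has a common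
-- element (all members avoiding a are excluded) or contains a triangle.
data StarOrTriangle (H : V → Set) : Set where
  star     : ∀ a → (∀ v → Avoids a v → ¬ H v) → StarOrTriangle H
  triangle : ∀ a b c → a ≢ b → b ≢ c → a ≢ c →
             H (pairV a b) → H (pairV b c) → H (pairV a c) → StarOrTriangle H

intersecting : ∀ {H : V → Set} → (∀ v → Dec (H v)) → (∀ {u v} → H u → H v → ¬ Adjacent u v) →
               StarOrTriangle H
intersecting {H} H? independent with ∃V? H?
... | no none = star 0F (λ v _ Hv → none (v , Hv))
... | yes (u , Hu) with ∃V? (λ v → avoids? (lo u) v ×-dec H? v)
...   | no none = star (lo u) (λ v av Hv → none (v , av , Hv))
...   | yes (v , v-avoids , Hv) with ∃V? (λ t → avoids? (hi u) t ×-dec H? t)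
...     | no none = star (hi u) (λ t av Ht → none (t , av , Ht))
...     | yes (t , t-avoids , Ht) =
  from-three (meets-other v (independent Hu Hv) v-avoids)
             (meets-other t (λ D → independent Hu Ht (disjoint-swapˡ D)) t-avoids)
  where
  a = lo u
  b = hi u
  from-three : (Σ (Fin 5) λ c → c ≢ a × c ≢ b × v ≡ pairV b c) →
               (Σ (Fin 5) λ d → d ≢ b × d ≢ a × t ≡ pairV a d) → StarOrTriangle H
  from-three (c , c≢a , c≢b , v≡) (d , d≢b , d≢a , t≡) = close (not-disjoint v-meets-t)
    where
    v-meets-t : ¬ Disjoint b c a d
    v-meets-t D = independent Hv Ht (subst₂ Adjacent (sym v≡) (sym t≡)
                    (pairV-adjacent (λ b≡c → c≢b (sym b≡c)) (λ a≡d → d≢a (sym a≡d)) D))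
    close : b ≡ a ⊎ b ≡ d ⊎ c ≡ a ⊎ c ≡ d → StarOrTriangle H
    close (inj₁ b≡a)               = ⊥-elim (lo≢hi u (sym b≡a))
    close (inj₂ (inj₁ b≡d))        = ⊥-elim (d≢b (sym b≡d))
    close (inj₂ (inj₂ (inj₁ c≡a))) = ⊥-elim (c≢a c≡a)
    close (inj₂ (inj₂ (inj₂ c≡d))) =
      triangle a b c (lo≢hi u) (λ b≡c → c≢b (sym b≡c)) (λ a≡c → c≢a (sym a≡c))
        (subst H (sym (pairV-lo-hi u)) Hu) (subst H v≡ Hv) (subst H (trans t≡ (cong (pairV a) (sym c≡d))) Ht)

Heavy : (V → ℕ) → ℕ → V → Set
Heavy n k v = 2 * k < n v

heavy-independent : ∀ {n k w} → w ≤ 4 * k → EdgeBound n w →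
                    ∀ {u v} → Heavy n k u → Heavy n k v → ¬ Adjacent u v
heavy-independent {n} {k} {w} w≤4k edge {u} {v} hu hv adj = <-irrefl refl (begin-strict
  4 * k              ≡⟨ double k ⟩
  2 * k + 2 * k      <⟨ +-mono-< hu hv ⟩
  n u + n v          ≤⟨ edge u v adj ⟩
  w                  ≤⟨ w≤4k ⟩
  4 * k              ∎)
  where
  double : ∀ k → 4 * k ≡ 2 * k + 2 * k
  double = solve-∀

AdmissibleStar : (V → ℕ) → ℕ → ℕ → Set
AdmissibleStar n k w = Σ (Permutation′ 5) λ π → Admissible (λ v → n (act π v)) k w

-- If all vertices avoiding 0 are light, the star of one of 1, 2, 3, 4 is admissible:
-- three times the total excess of these four stars is the sum, over the three
-- perfect matchings of {1,2,3,4}, of the matching budgets, hence at most 12w.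
light-off-star₀ : ∀ {m k w} → EdgeBound m w → (∀ v → Avoids 0F v → m v ≤ 2 * k) → AdmissibleStar m k w
light-off-star₀ {m} {k} {w} edge light = choose (pigeonhole-4 X₁ X₂ X₃ X₄ w total)
  where
  ℓ : ∀ v → {True (avoids? 0F v)} → m v ≤ 2 * k
  ℓ v {t} = light v (toWitness t)
  e! : ∀ u v → {True (adjacent? u v)} → m u + m v ≤ w
  e! u v {t} = edge u v (toWitness t)
  x : V → ℕ
  x v = m v ∸ k
  X₁ X₂ X₃ X₄ : ℕ
  X₁ = x v01 + x v12 + x v13 + x v14
  X₂ = x v12 + x v02 + x v23 + x v24
  X₃ = x v13 + x v23 + x v03 + x v34
  X₄ = x v14 + x v24 + x v34 + x v04
  identity : ∀ y₁ y₂ y₃ y₄ z₁₂ z₁₃ z₁₄ z₂₃ z₂₄ z₃₄ →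
    3 * ((y₁ + z₁₂ + z₁₃ + z₁₄) + (z₁₂ + y₂ + z₂₃ + z₂₄) + (z₁₃ + z₂₃ + y₃ + z₃₄) + (z₁₄ + z₂₄ + z₃₄ + y₄))
    ≡ (y₃ + y₄ + y₁ + y₂ + 6 * (z₁₂ + z₃₄)) + (y₂ + y₄ + y₁ + y₃ + 6 * (z₁₃ + z₂₄))
      + (y₂ + y₃ + y₁ + y₄ + 6 * (z₁₄ + z₂₃))
  identity = solve-∀
  twelve : ∀ w → 4 * w + 4 * w + 4 * w ≡ 3 * (4 * w)
  twelve = solve-∀
  total : X₁ + X₂ + X₃ + X₄ ≤ 4 * w
  total = *-cancelˡ-≤ 3 (begin
    3 * (X₁ + X₂ + X₃ + X₄)
      ≡⟨ identity (x v01) (x v02) (x v03) (x v04) (x v12) (x v13) (x v14) (x v23) (x v24) (x v34) ⟩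
    _ ≤⟨ +-mono-≤ (+-mono-≤
           (matching-excess-≤ k (ℓ v12) (ℓ v34) (e! v12 v34) (e! v03 v12) (e! v04 v12) (e! v01 v34) (e! v02 v34))
           (matching-excess-≤ k (ℓ v13) (ℓ v24) (e! v13 v24) (e! v02 v13) (e! v04 v13) (e! v01 v24) (e! v03 v24)))
           (matching-excess-≤ k (ℓ v14) (ℓ v23) (e! v14 v23) (e! v02 v14) (e! v03 v14) (e! v01 v23) (e! v04 v23)) ⟩
    4 * w + 4 * w + 4 * w
      ≡⟨ twelve w ⟩
    3 * (4 * w) ∎)
  choose : X₁ ≤ w ⊎ X₂ ≤ w ⊎ X₃ ≤ w ⊎ X₄ ≤ w → AdmissibleStar m k w
  choose (inj₁ X≤)               = transpose 0F 1F , light-but₁ X≤ (ℓ v12) (ℓ v13) (ℓ v14)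
  choose (inj₂ (inj₁ X≤))        = transpose 0F 2F , light-but₂ X≤ (ℓ v12) (ℓ v23) (ℓ v24)
  choose (inj₂ (inj₂ (inj₁ X≤))) = transpose 0F 3F , light-but₃ X≤ (ℓ v13) (ℓ v23) (ℓ v34)
  choose (inj₂ (inj₂ (inj₂ X≤))) = transpose 0F 4F , light-but₄ X≤ (ℓ v14) (ℓ v24) (ℓ v34)

avoids-transpose : ∀ a v → Avoids 0F v → Avoids a (act (transpose 0F a) v)
avoids-transpose = from-yes (all? λ a → ∀V? λ v → avoids? 0F v →-dec avoids? a (act (transpose 0F a) v))

light-off-star : ∀ {n k w} a → EdgeBound n w → (∀ v → Avoids a v → n v ≤ 2 * k) → AdmissibleStar n k w
light-off-star {n} {k} {w} a edge light =
  relabel (light-off-star₀ {m} (edge-bound-act {n} τ edge) (λ v av → light (act τ v) (avoids-transpose a v av)))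
  where
  τ : Permutation′ 5
  τ = transpose 0F a
  m : V → ℕ
  m v = n (act τ v)
  relabel : AdmissibleStar m k w → AdmissibleStar n k w
  relabel (ρ , adm) = ρ ∘ₚ τ ,
    admissible-cong {λ v → m (act ρ v)} {λ v → n (act (ρ ∘ₚ τ) v)} (λ v → cong n (act-∘ ρ τ v)) adm

star₀ : List V
star₀ = v01 ∷ v02 ∷ v03 ∷ v04 ∷ []

HeavyNeighbour : (V → ℕ) → ℕ → V → Set
HeavyNeighbour n k v = Σ V λ t → Adjacent v t × Heavy n k t

-- A relabelled star each of whose vertices is adjacent to a heavy vertex is admissible:
-- all of its vertices are light with excess at most w/4.
next-to-heavy : ∀ {n k w} π → w ≤ 4 * k → EdgeBound n w →
  All (λ v → HeavyNeighbour n k (act π v)) star₀ →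
  Admissible (λ v → n (act π v)) k w
next-to-heavy {n} {k} {w} π w≤4k edge (t₁ ∷ t₂ ∷ t₃ ∷ t₄ ∷ []) =
  light-but₄ (quarters-≤ {x v01} {x v02} {x v03} {x v04} (quarter t₁) (quarter t₂) (quarter t₃) (quarter t₄))
    (light t₁) (light t₂) (light t₃)
  where
  x : V → ℕ
  x v = n (act π v) ∸ k
  beside : ∀ {v} → HeavyNeighbour n k v → n v ≤ 2 * k × 4 * (n v ∸ k) ≤ w
  beside {v} (t , adj , heavy) = beside-heavy k (edge v t adj) heavy w≤4k
  light : ∀ {v} → HeavyNeighbour n k v → n v ≤ 2 * k
  light t = proj₁ (beside t)
  quarter : ∀ {v} → HeavyNeighbour n k v → 4 * (n v ∸ k) ≤ w
  quarter t = proj₂ (beside t)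

-- Around a triangle {a,b},{b,c},{a,c}, the star of an element outside {a,b,c} has every
-- vertex adjacent to a triangle vertex (checked by evaluation).
NextToTriangle : Fin 5 → Fin 5 → Fin 5 → V → Set
NextToTriangle a b c v = Adjacent v (pairV a b) ⊎ Adjacent v (pairV b c) ⊎ Adjacent v (pairV a c)

triangle-star : ∀ a b c → a ≢ b → b ≢ c → a ≢ c → Σ (Fin 5) λ e →
  All (λ v → NextToTriangle a b c (act (transpose 0F e) v)) star₀
triangle-star = from-yes (all? λ a → all? λ b → all? λ c →
  ¬? (a ≟ b) →-dec ¬? (b ≟ c) →-dec ¬? (a ≟ c) →-dec any? λ e → All.all? (λ v →
    let u = act (transpose 0F e) v
    in adjacent? u (pairV a b) ⊎-dec adjacent? u (pairV b c) ⊎-dec adjacent? u (pairV a c)) star₀)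

-- Some relabelled star is admissible: classify the heavy vertices, which are pairwise
-- non-adjacent, as lying in a star or containing a triangle.
select : ∀ {n k w} → w ≤ 4 * k → EdgeBound n w → AdmissibleStar n k w
select {n} {k} {w} w≤4k edge =
  by-shape (intersecting {Heavy n k} (λ v → 2 * k <? n v) (heavy-independent {n} {k} w≤4k edge))
  where
  by-shape : StarOrTriangle (Heavy n k) → AdmissibleStar n k w
  by-shape (star a none) = light-off-star {n} {k} a edge (λ v av → ≮⇒≥ (none v av))
  by-shape (triangle a b c a≢b b≢c a≢c Hab Hbc Hac) = around (triangle-star a b c a≢b b≢c a≢c)
    where
    heavy-neighbour : ∀ {v} → NextToTriangle a b c v → HeavyNeighbour n k v
    heavy-neighbour (inj₁ adj)        = pairV a b , adj , Hab
    heavy-neighbour (inj₂ (inj₁ adj)) = pairV b c , adj , Hbc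
    heavy-neighbour (inj₂ (inj₂ adj)) = pairV a c , adj , Hac
    around : Σ (Fin 5) (λ e → All (λ v → NextToTriangle a b c (act (transpose 0F e) v)) star₀) →
             AdmissibleStar n k w
    around (e , next) =
      transpose 0F e , next-to-heavy {n} {k} (transpose 0F e) w≤4k edge (All.map heavy-neighbour next)

petersen-weighted : ∀ {n k w} → w ≤ 4 * k → EdgeBound n w → WeightedColouring n (k + w)
petersen-weighted {n} {k} {w} w≤4k edge = colour-from (select {n} {k} {w} w≤4k edge)
  where
  colour-from : AdmissibleStar n k w → WeightedColouring n (k + w)
  colour-from (π , adm) =
    pullback π {n} (StarLayout.colouring {λ v → n (act π v)} {k} {w} (edge-bound-act {n} π edge) adm)

all-lookup : ∀ {A : Set} {P : A → Set} {xs : List A} → All P xs → ∀ i → P (lookup xs i)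
all-lookup (p ∷ _)  zero    = p
all-lookup (_ ∷ ps) (suc i) = all-lookup ps i

unique-lookup-injective : ∀ {A : Set} {xs : List A} → Unique xs → ∀ i j → lookup xs i ≡ lookup xs j → i ≡ j
unique-lookup-injective (_ ∷ _)  zero    zero    _ = refl
unique-lookup-injective (x∉ ∷ _) zero    (suc j) e = ⊥-elim (all-lookup x∉ j e)
unique-lookup-injective (x∉ ∷ _) (suc i) zero    e = ⊥-elim (all-lookup x∉ i (sym e))
unique-lookup-injective (_ ∷ u)  (suc i) (suc j) e = cong suc (unique-lookup-injective u i j e)

lookup-cong : ∀ {A : Set} {xs ys : List A} → xs ≡ ys → (i : Fin (length xs)) (j : Fin (length ys)) →
              toℕ i ≡ toℕ j → lookup xs i ≡ lookup ys j
lookup-cong {xs = xs} refl i j i≡j = cong (lookup xs) (toℕ-injective i≡j)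

module Blowup {N : ℕ} (G : Graph N) (f : Fin N → PVertex)
  (within      : ∀ x y → x ≢ y → f x ≡ f y → Adj G x y)
  (across      : ∀ x y → f x ≢ f y → PAdj (f x) (f y) → Adj G x y)
  (only-across : ∀ x y → f x ≢ f y → Adj G x y → PAdj (f x) (f y)) where

  part : Fin N → V
  part x = toV (f x)

  members : V → List (Fin N)
  members v = filter (λ x → part x ≟V v) (allFin N)

  weight : V → ℕ
  weight v = length (members v)

  member-part : ∀ x → x ∈ members (part x)
  member-part x = ∈-filter⁺ (λ y → part y ≟V part x) (∈-allFin x) refl

  part-member : ∀ {v x} → x ∈ members v → part x ≡ v
  part-member {v} x∈ = proj₂ (∈-filter⁻ (λ y → part y ≟V v) {xs = allFin N} x∈)

  members-unique : ∀ v → Unique (members v)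
  members-unique v = filter⁺ (λ y → part y ≟V v) {xs = allFin N} (allFin⁺ N)

  rank : Fin N → ℕ
  rank x = toℕ (index (member-part x))

  rank<weight : ∀ x → rank x < weight (part x)
  rank<weight x = toℕ<n (index (member-part x))

  rank-injective : ∀ {x y} → part x ≡ part y → rank x ≡ rank y → x ≡ y
  rank-injective {x} {y} same-part same-rank =
    trans (lookup-index (member-part x))
      (trans (lookup-cong (cong members same-part) (index (member-part x)) (index (member-part y)) same-rank)
             (sym (lookup-index (member-part y))))

  adjacent-parts-clique : ∀ u v → Adjacent u v → HasClique G (weight u + weight v)
  adjacent-parts-clique u v adj = subst (HasClique G) (length-++ (members u)) (lookup L , injective , clique)
    where
    L = members u ++ members v
    L-unique : Unique L
    L-unique = ++⁺ (members-unique u) (members-unique v) λ (x∈u , x∈v) →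
      adjacent-irreflexive (subst (Adjacent u) (trans (sym (part-member x∈v)) (part-member x∈u)) adj)
    injective : ∀ {i j} → lookup L i ≡ lookup L j → i ≡ j
    injective {i} {j} = unique-lookup-injective L-unique i j
    side : ∀ i → part (lookup L i) ≡ u ⊎ part (lookup L i) ≡ v
    side i with ∈-++⁻ (members u) (∈-lookup {xs = L} i)
    ... | inj₁ x∈u = inj₁ (part-member x∈u)
    ... | inj₂ x∈v = inj₂ (part-member x∈v)
    sides-adjacent : ∀ {x y} → x ≢ y → x ≡ u ⊎ x ≡ v → y ≡ u ⊎ y ≡ v → Adjacent x y
    sides-adjacent x≢y (inj₁ refl) (inj₁ refl) = ⊥-elim (x≢y refl)
    sides-adjacent x≢y (inj₁ refl) (inj₂ refl) = adj
    sides-adjacent x≢y (inj₂ refl) (inj₁ refl) = adjacent-sym adj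
    sides-adjacent x≢y (inj₂ refl) (inj₂ refl) = ⊥-elim (x≢y refl)
    clique : ∀ i j → i ≢ j → Adj G (lookup L i) (lookup L j)
    clique i j i≢j with part (lookup L i) ≟V part (lookup L j)
    ... | yes same = within (lookup L i) (lookup L j) (λ e → i≢j (injective e)) (toV-injective same)
    ... | no differ = across (lookup L i) (lookup L j) (λ e → differ (cong toV e))
                        (adjacent-toV (f (lookup L i)) (f (lookup L j)) (sides-adjacent differ (side i) (side j)))

  edge-bound : ∀ {w} → (∀ k → HasClique G k → k ≤ w) → EdgeBound weight w
  edge-bound maximal u v adj = maximal _ (adjacent-parts-clique u v adj)

  colourable : ∀ {c} → WeightedColouring weight c → Colourable G c
  colourable {c} χ = colour , proper
    where
    open WeightedColouring χ renaming (colour to colourᵥ; proper to properᵥ)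
    colour : Fin N → Fin c
    colour x = fromℕ< (bounded (part x) (rank<weight x))
    same-colour : ∀ {x y} → colour x ≡ colour y → colourᵥ (part x) (rank x) ≡ colourᵥ (part y) (rank y)
    same-colour e = trans (sym (toℕ-fromℕ< _)) (trans (cong toℕ e) (toℕ-fromℕ< _))
    proper : ∀ x y → Adj G x y → colour x ≢ colour y
    proper x y xy e with part x ≟V part y
    ... | yes same = irrefl G (subst (Adj G x) (sym (rank-injective same equal-rank)) xy)
      where
      equal-rank : rank x ≡ rank y
      equal-rank = injective (part y) (subst (λ v → rank x < weight v) same (rank<weight x)) (rank<weight y)
                     (subst (λ v → colourᵥ v (rank x) ≡ colourᵥ (part y) (rank y)) same (same-colour e))
    ... | no differ = properᵥ (toV-adjacent (f x) (f y) (only-across x y (λ e' → differ (cong toV e')) xy))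
                        (rank<weight x) (rank<weight y) (same-colour e)

quarter-up : ℕ → ℕ
quarter-up w = (w + 3) / 4

ceil5/4≡ : ∀ w → ceil5/4 w ≡ quarter-up w + w
ceil5/4≡ w = begin-equality
  (5 * w + 3) / 4             ≡⟨ cong (_/ 4) (regroup w) ⟩
  ((w + 3) + w * 4) / 4       ≡⟨ +-distrib-/-∣ʳ (w + 3) (divides w refl) ⟩
  quarter-up w + w * 4 / 4    ≡⟨ cong (quarter-up w +_) (m*n/n≡m w 4) ⟩
  quarter-up w + w            ∎
  where
  regroup : ∀ w → 5 * w + 3 ≡ (w + 3) + w * 4
  regroup = solve-∀

≤4*quarter-up : ∀ w → w ≤ 4 * quarter-up w
≤4*quarter-up w = +-cancelʳ-≤ 3 w (4 * quarter-up w) (begin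
  w + 3                                    ≡⟨ m≡m%n+[m/n]*n (w + 3) 4 ⟩
  (w + 3) % 4 + quarter-up w * 4           ≤⟨ +-monoˡ-≤ (quarter-up w * 4) (s≤s⁻¹ (m%n<n (w + 3) 4)) ⟩
  3 + quarter-up w * 4                     ≡⟨ +-comm 3 (quarter-up w * 4) ⟩
  quarter-up w * 4 + 3                     ≡⟨ cong (_+ 3) (*-comm (quarter-up w) 4) ⟩
  4 * quarter-up w + 3                     ∎)

theorem5p3 : ∀ {n : ℕ} (G : Graph n) → IsPetersenBlowup G →
    ∀ (w : ℕ) → IsCliqueNumber G w → Colourable G (ceil5/4 w)
theorem5p3 G (f , within , across , only-across) w (_ , maximal) =
  subst (Colourable G) (sym (ceil5/4≡ w))
    (colourable (petersen-weighted (≤4*quarter-up w) (edge-bound maximal)))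
  where open Blowup G f within across only-across
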